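{- Let $L\subseteq\{0,1\}^*$ be a 0-1-symmetric language that contains either both $1001$ and $0110$ or both $1010$ and $0101$, but does not contain all four of these words. Then $\mathcal{G}_L$ contains all cographs.
   Context: All graphs are finite, simple, undirected, with nonempty vertex sets, and graph classes are considered up to isomorphism. The class of cographs is the smallest class of graphs containing the one-vertex graph $K_1$ and closed under disjoint union and under join (the join of vertex-disjoint graphs $G_1,G_2$ is their disjoint union plus all edges between a vertex of $G_1$ and a vertex of $G_2$). For $w\in\{0,1\}^*$ let $\widetilde{w}$ be obtained from $w$ by exchanging the letters 0 and 1; a language $L\subseteq\{0,1\}^*$ is 0-1-symmetric if $L=\{\widetilde w : w\in L\}$. For an alphabet $V$ and distinct $u,v\in V$, $h_{u,v}:V^*\to\{0,1\}^*$ is the monoid morphism with $u\mapsto 0$, $v\mapsto 1$ and $x\mapsto\lambda$ (empty word) for all other letters $x$. For a 0-1-symmetric $L$ and a nonempty word $w$ whose set of occurring letters is $V$, $G(L,w)$ is the graph with vertex set $V$ in which distinct $u,v$ are adjacent iff $h_{u,v}(w)\in L$. A graph is $L$-representable if it is isomorphic to some $G(L,w)$, and $\mathcal{G}_L$ denotes the class of all $L$-representable graphs. -}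

module Defs where

open import Data.Nat using (ℕ; _+_)
open import Data.Bool using (Bool; true; false; not)
open import Data.Fin using (Fin; splitAt; _≟_)
open import Data.List using (List; []; _∷_; map)
open import Data.List.Membership.Propositional using (_∈_)
open import Data.Sum using (_⊎_; inj₁; inj₂)
open import Data.Product using (Σ; _×_; _,_; ∃)
open import Data.Empty using (⊥; ⊥-elim)
open import Data.Unit using (⊤)
open import Relation.Nullary using (¬_; yes; no)
open import Relation.Binary.PropositionalEquality using (_≡_; _≢_; refl; cong; subst) renaming (sym to ≡-sym)
open import Function.Bundles using (_↔_; Inverse; _⇔_; Equivalence)

record Graph : Set₁ where
  field
    V     : ℕ
    Adj   : Fin V → Fin V → Set
    sym   : ∀ {u v} → Adj u v → Adj v u
    irr   : ∀ {u} → ¬ Adj u u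
open Graph public

record _≅_ (G H : Graph) : Set where
  field
    bij : Fin (V G) ↔ Fin (V H)
    adj : ∀ u v → Adj G u v ⇔ Adj H (Inverse.to bij u) (Inverse.to bij v)

K1 : Graph
K1 = record { V = 1 ; Adj = λ _ _ → ⊥ ; sym = λ () ; irr = λ () }

-- adjacency of the disjoint union (X = ⊥) or join (X = ⊤)
combAdj : ∀ (G H : Graph) → Set → Fin (V G) ⊎ Fin (V H) → Fin (V G) ⊎ Fin (V H) → Set
combAdj G H X (inj₁ u) (inj₁ v) = Adj G u v
combAdj G H X (inj₂ u) (inj₂ v) = Adj H u v
combAdj G H X (inj₁ u) (inj₂ v) = X
combAdj G H X (inj₂ u) (inj₁ v) = X

combSym : ∀ G H X a b → combAdj G H X a b → combAdj G H X b a
combSym G H X (inj₁ u) (inj₁ v) p = sym G p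
combSym G H X (inj₂ u) (inj₂ v) p = sym H p
combSym G H X (inj₁ u) (inj₂ v) p = p
combSym G H X (inj₂ u) (inj₁ v) p = p

combIrr : ∀ G H X a → ¬ combAdj G H X a a
combIrr G H X (inj₁ u) = irr G
combIrr G H X (inj₂ u) = irr H

comb : Set → Graph → Graph → Graph
comb X G H = record
  { V   = V G + V H
  ; Adj = λ u v → combAdj G H X (splitAt (V G) u) (splitAt (V G) v)
  ; sym = λ {u} {v} → combSym G H X (splitAt (V G) u) (splitAt (V G) v)
  ; irr = λ {u} → combIrr G H X (splitAt (V G) u)
  }

_⊕_ : Graph → Graph → Graph
G ⊕ H = comb ⊥ G H

_⊗_ : Graph → Graph → Graph
G ⊗ H = comb ⊤ G H

data IsCograph : Graph → Set₁ where
  k1    : IsCograph K1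
  union : ∀ {G H} → IsCograph G → IsCograph H → IsCograph (G ⊕ H)
  join  : ∀ {G H} → IsCograph G → IsCograph H → IsCograph (G ⊗ H)
  iso   : ∀ {G H} → G ≅ H → IsCograph G → IsCograph H

-- Languages over {0,1}; the letter 0 is false, 1 is true.

Language : Set₁
Language = List Bool → Set

flip01 : List Bool → List Bool
flip01 = map not

ZeroOneSymmetric : Language → Set
ZeroOneSymmetric L = ∀ w → L w ⇔ L (flip01 w)

h : ∀ {n} → Fin n → Fin n → List (Fin n) → List Bool
h u v [] = []
h u v (x ∷ w) with x ≟ u | x ≟ v
... | yes _ | _     = false ∷ h u v w
... | no _  | yes _ = true ∷ h u v w
... | no _  | no _  = h u v w

h-swap : ∀ {n} (u v : Fin n) → u ≢ v → ∀ w → h v u w ≡ flip01 (h u v w)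
h-swap u v d [] = refl
h-swap u v d (x ∷ w) with x ≟ u | x ≟ v
... | yes refl | yes refl = ⊥-elim (d refl)
... | yes refl | no _     = cong (true ∷_) (h-swap u v d w)
... | no _     | yes refl = cong (false ∷_) (h-swap u v d w)
... | no _     | no _     = h-swap u v d w

-- G(L, w) for a word w over the alphabet Fin n (the vertex set is Fin n;
-- the requirement that every letter occurs in w is imposed in
-- Representable below).
GL : (L : Language) → ZeroOneSymmetric L → (n : ℕ) → List (Fin n) → Graph
GL L symL n w = record
  { V   = n
  ; Adj = λ u v → (u ≢ v) × L (h u v w)
  ; sym = λ { {u} {v} (d , p) →
              (λ e → d (≡-sym e)) ,
              subst L (≡-sym (h-swap u v d w)) (Equivalence.to (symL (h u v w)) p) }
  ; irr = λ { (d , _) → d refl }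
  }

Representable : (L : Language) → ZeroOneSymmetric L → Graph → Set
Representable L symL G =
  Σ ℕ λ n → Σ (List (Fin n)) λ w →
    (w ≢ []) × (∀ (x : Fin n) → x ∈ w) × (G ≅ GL L symL n w)

{-# OPTIONS --safe #-}
-- Represent a graph by a word p q in which p and q are permutations of its
-- vertices. For distinct u, v the projection h_{u,v}(p q) is then one of
-- 0101, 0110, 1001, 1010, so whether u and v are adjacent depends only on
-- whether their relative orders in p and in q agree, and the hypotheses on L
-- make one of these outcomes an edge and the other a non-edge: by 0-1-symmetry
-- L contains exactly one of the pairs {1001, 0110} and {1010, 0101}. Such
-- representations are closed under isomorphism, disjoint union and join:
-- list the vertices of G before those of H in p, and in q either before or
-- after them, whichever makes the cross pairs non-adjacent (union) or
-- adjacent (join).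
module Submission where

open import Defs
open import Data.Bool using (Bool; true; false; not)
open import Data.Nat using (ℕ; _+_)
open import Data.List using (List; _∷_; []; [_]; _++_; map)
open import Data.List.Properties using (++-identityʳ; map-++)
open import Data.List.Membership.Propositional using (_∈_)
open import Data.List.Membership.Propositional.Properties using (∈-++⁺ˡ)
open import Data.List.Relation.Unary.Any using (here; there)
open import Data.List.Relation.Unary.Any.Properties using (¬Any[])
open import Data.Fin using (Fin; zero; splitAt; _↑ˡ_; _↑ʳ_; _≟_)
open import Data.Fin.Properties
  using (↑ˡ-injective; ↑ʳ-injective; splitAt-↑ˡ; splitAt-↑ʳ; splitAt⁻¹-↑ˡ; splitAt⁻¹-↑ʳ)
open import Data.Product using (_×_; _,_)
open import Data.Sum using (_⊎_; inj₁; inj₂)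
open import Data.Empty using (⊥-elim)
open import Data.Unit using (tt)
open import Function.Definitions using (Injective)
open import Function.Bundles using (Inverse; Equivalence; _⇔_; mk⇔)
open import Function.Construct.Identity using (↔-id; ⇔-id)
open import Function.Construct.Symmetry using (⇔-sym)
open import Function.Construct.Composition using (_⇔-∘_)
open import Relation.Nullary using (¬_; yes; no; contradiction)
open import Relation.Binary.PropositionalEquality
  using (_≡_; _≢_; refl; cong; cong₂; subst; subst₂; trans; module ≡-Reasoning)
  renaming (sym to ≡-sym)

open Equivalence using (to; from)

h-++ : ∀ {n} (u v : Fin n) xs ys → h u v (xs ++ ys) ≡ h u v xs ++ h u v ys
h-++ u v []       ys = refl
h-++ u v (x ∷ xs) ys with x ≟ u | x ≟ v
... | yes _ | _     = cong (false ∷_) (h-++ u v xs ys)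
... | no _  | yes _ = cong (true ∷_) (h-++ u v xs ys)
... | no _  | no _  = h-++ u v xs ys

h≡false∷⇒∈ : ∀ {n} {u v : Fin n} w {r} → h u v w ≡ false ∷ r → u ∈ w
h≡false∷⇒∈ {u = u} {v} (x ∷ w) eq with x ≟ u | x ≟ v
h≡false∷⇒∈ (x ∷ w) _    | yes x≡u | _     = here (≡-sym x≡u)
h≡false∷⇒∈ (x ∷ w) ()   | no _    | yes _
h≡false∷⇒∈ (x ∷ w) eq   | no _    | no _  = there (h≡false∷⇒∈ w eq)

h-[]-cong : ∀ {m n} {x u v : Fin m} {y u′ v′ : Fin n} →
  (y ≡ u′ ⇔ x ≡ u) → (x ≢ u → y ≡ v′ ⇔ x ≡ v) → h u′ v′ [ y ] ≡ h u v [ x ]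
h-[]-cong {x = x} {u} {v} {y} {u′} {v′} eu ev with y ≟ u′ | x ≟ u
... | yes _   | yes _   = refl
... | yes y≡u | no x≢u  = contradiction (to eu y≡u) x≢u
... | no y≢u  | yes x≡u = contradiction (from eu x≡u) y≢u
... | no _    | no x≢u  with y ≟ v′ | x ≟ v
...   | yes _   | yes _   = refl
...   | yes y≡v | no x≢v  = contradiction (to (ev x≢u) y≡v) x≢v
...   | no y≢v  | yes x≡v = contradiction (from (ev x≢u) x≡v) y≢v
...   | no _    | no _    = refl

h-[]-absent : ∀ {n} {y u v : Fin n} → y ≢ u → y ≢ v → h u v [ y ] ≡ []
h-[]-absent {y = y} {u} {v} y≢u y≢v with y ≟ u | y ≟ v
... | yes y≡u | _       = contradiction y≡u y≢u
... | no _    | yes y≡v = contradiction y≡v y≢v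
... | no _    | no _    = refl

module _ {m n} (f : Fin m → Fin n) {u′ v′ : Fin n} where

  h-map : ∀ {u v : Fin m} → (∀ x → h u′ v′ [ f x ] ≡ h u v [ x ]) →
    ∀ w → h u′ v′ (map f w) ≡ h u v w
  h-map         eq []      = refl
  h-map {u} {v} eq (x ∷ w) = begin
    h u′ v′ ([ f x ] ++ map f w)          ≡⟨ h-++ u′ v′ [ f x ] (map f w) ⟩
    h u′ v′ [ f x ] ++ h u′ v′ (map f w)  ≡⟨ cong₂ _++_ (eq x) (h-map eq w) ⟩
    h u v [ x ] ++ h u v w                ≡⟨ h-++ u v [ x ] w ⟨
    h u v ([ x ] ++ w)                    ∎
    where open ≡-Reasoning

  h-map-absent : (∀ x → f x ≢ u′) → (∀ x → f x ≢ v′) → ∀ w → h u′ v′ (map f w) ≡ []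
  h-map-absent fx≢u′ fx≢v′ []      = refl
  h-map-absent fx≢u′ fx≢v′ (x ∷ w) =
    trans (h-++ u′ v′ [ f x ] (map f w))
          (cong₂ _++_ (h-[]-absent (fx≢u′ x) (fx≢v′ x)) (h-map-absent fx≢u′ fx≢v′ w))

module _ {m n} {f : Fin m → Fin n} (f-inj : Injective _≡_ _≡_ f) where

  private
    f≡f⇔≡ : ∀ {x y} → f x ≡ f y ⇔ x ≡ y
    f≡f⇔≡ = mk⇔ f-inj (cong f)

  h-map-injective : ∀ u v w → h (f u) (f v) (map f w) ≡ h u v w
  h-map-injective u v = h-map f (λ _ → h-[]-cong f≡f⇔≡ (λ _ → f≡f⇔≡))

  h-map-absentʳ : ∀ {v′} → (∀ x → f x ≢ v′) → ∀ u w → h (f u) v′ (map f w) ≡ h u u w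
  h-map-absentʳ fx≢v′ u = h-map f (λ x → h-[]-cong f≡f⇔≡ (λ x≢u →
    mk⇔ (λ fx≡v′ → contradiction fx≡v′ (fx≢v′ x)) (λ x≡u → contradiction x≡u x≢u)))

-- h u u w records each occurrence of u in w by a 0.
IsPermutation : ∀ {n} → List (Fin n) → Set
IsPermutation w = ∀ u → h u u w ≡ [ false ]

juxtapose : ∀ {A : Set} → Bool → List A → List A → List A
juxtapose true  xs ys = xs ++ ys
juxtapose false xs ys = ys ++ xs

h-juxtapose : ∀ {n} (u v : Fin n) s xs ys →
  h u v (juxtapose s xs ys) ≡ juxtapose s (h u v xs) (h u v ys)
h-juxtapose u v true  xs ys = h-++ u v xs ys
h-juxtapose u v false xs ys = h-++ u v ys xs

juxtapose-identityˡ : ∀ {A : Set} s (ys : List A) → juxtapose s [] ys ≡ ys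
juxtapose-identityˡ true  ys = refl
juxtapose-identityˡ false ys = ++-identityʳ ys

juxtapose-identityʳ : ∀ {A : Set} s (xs : List A) → juxtapose s xs [] ≡ xs
juxtapose-identityʳ true  xs = ++-identityʳ xs
juxtapose-identityʳ false xs = refl

module Blocks (m n : ℕ) where

  ↑ˡ≢↑ʳ : ∀ i j → i ↑ˡ n ≢ m ↑ʳ j
  ↑ˡ≢↑ʳ i j eq
    with () ← trans (≡-sym (splitAt-↑ˡ m i n)) (trans (cong (splitAt m) eq) (splitAt-↑ʳ m n j))

  data Side : Fin (m + n) → Set where
    left  : ∀ i → Side (i ↑ˡ n)
    right : ∀ j → Side (m ↑ʳ j)

  side : ∀ u → Side u
  side u with splitAt m {n} u in eq
  ... | inj₁ i = subst Side (splitAt⁻¹-↑ˡ eq) (left i)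
  ... | inj₂ j = subst Side (splitAt⁻¹-↑ʳ eq) (right j)

  private
    ↑ˡ-inj : Injective _≡_ _≡_ (λ (i : Fin m) → i ↑ˡ n)
    ↑ˡ-inj = ↑ˡ-injective n _ _

    ↑ʳ-inj : Injective _≡_ _≡_ (λ (j : Fin n) → m ↑ʳ j)
    ↑ʳ-inj = ↑ʳ-injective m _ _

  blocks : Bool → List (Fin m) → List (Fin n) → List (Fin (m + n))
  blocks s a c = juxtapose s (map (_↑ˡ n) a) (map (m ↑ʳ_) c)

  h-blocks-↑ˡ : ∀ s i j a c → h (i ↑ˡ n) (j ↑ˡ n) (blocks s a c) ≡ h i j a
  h-blocks-↑ˡ s i j a c = begin
    h (i ↑ˡ n) (j ↑ˡ n) (blocks s a c)
      ≡⟨ h-juxtapose (i ↑ˡ n) (j ↑ˡ n) s _ _ ⟩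
    juxtapose s (h (i ↑ˡ n) (j ↑ˡ n) (map (_↑ˡ n) a)) (h (i ↑ˡ n) (j ↑ˡ n) (map (m ↑ʳ_) c))
      ≡⟨ cong₂ (juxtapose s) (h-map-injective ↑ˡ-inj i j a)
                             (h-map-absent (m ↑ʳ_) (λ x e → ↑ˡ≢↑ʳ i x (≡-sym e))
                                                   (λ x e → ↑ˡ≢↑ʳ j x (≡-sym e)) c) ⟩
    juxtapose s (h i j a) []
      ≡⟨ juxtapose-identityʳ s (h i j a) ⟩
    h i j a ∎
    where open ≡-Reasoning

  h-blocks-↑ʳ : ∀ s i j a c → h (m ↑ʳ i) (m ↑ʳ j) (blocks s a c) ≡ h i j c
  h-blocks-↑ʳ s i j a c = begin
    h (m ↑ʳ i) (m ↑ʳ j) (blocks s a c)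
      ≡⟨ h-juxtapose (m ↑ʳ i) (m ↑ʳ j) s _ _ ⟩
    juxtapose s (h (m ↑ʳ i) (m ↑ʳ j) (map (_↑ˡ n) a)) (h (m ↑ʳ i) (m ↑ʳ j) (map (m ↑ʳ_) c))
      ≡⟨ cong₂ (juxtapose s) (h-map-absent (_↑ˡ n) (λ x → ↑ˡ≢↑ʳ x i) (λ x → ↑ˡ≢↑ʳ x j) a)
                             (h-map-injective ↑ʳ-inj i j c) ⟩
    juxtapose s [] (h i j c)
      ≡⟨ juxtapose-identityˡ s (h i j c) ⟩
    h i j c ∎
    where open ≡-Reasoning

  h-blocks-cross : ∀ s i j a c →
    h (i ↑ˡ n) (m ↑ʳ j) (blocks s a c) ≡ juxtapose s (h i i a) (map not (h j j c))
  h-blocks-cross s i j a c = begin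
    h (i ↑ˡ n) (m ↑ʳ j) (blocks s a c)
      ≡⟨ h-juxtapose (i ↑ˡ n) (m ↑ʳ j) s _ _ ⟩
    juxtapose s (h (i ↑ˡ n) (m ↑ʳ j) (map (_↑ˡ n) a)) (h (i ↑ˡ n) (m ↑ʳ j) (map (m ↑ʳ_) c))
      ≡⟨ cong₂ (juxtapose s) (h-map-absentʳ ↑ˡ-inj (λ x → ↑ˡ≢↑ʳ x j) i a) swapped ⟩
    juxtapose s (h i i a) (map not (h j j c)) ∎
    where
    open ≡-Reasoning
    swapped : h (i ↑ˡ n) (m ↑ʳ j) (map (m ↑ʳ_) c) ≡ map not (h j j c)
    swapped = trans (h-swap (m ↑ʳ j) (i ↑ˡ n) (λ e → ↑ˡ≢↑ʳ i j (≡-sym e)) (map (m ↑ʳ_) c))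
                    (cong flip01 (h-map-absentʳ ↑ʳ-inj (λ x e → ↑ˡ≢↑ʳ i x (≡-sym e)) j c))

  blocks-perm : ∀ s a c → IsPermutation a → IsPermutation c → IsPermutation (blocks s a c)
  blocks-perm s a c a-perm c-perm u with side u
  ... | left i  = trans (h-blocks-↑ˡ s i i a c) (a-perm i)
  ... | right j = trans (h-blocks-↑ʳ s j j a c) (c-perm j)

  h-blocks-cross-perm : ∀ s a c → IsPermutation a → IsPermutation c → ∀ i j →
    h (i ↑ˡ n) (m ↑ʳ j) (blocks s a c) ≡ juxtapose s [ false ] [ true ]
  h-blocks-cross-perm s a c a-perm c-perm i j =
    trans (h-blocks-cross s i j a c) (cong₂ (juxtapose s) (a-perm i) (cong (map not) (c-perm j)))

module _ (X : Set) (G H : Graph) where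

  comb-adj-↑ˡ : ∀ i j → Adj (comb X G H) (i ↑ˡ V H) (j ↑ˡ V H) ⇔ Adj G i j
  comb-adj-↑ˡ i j rewrite splitAt-↑ˡ (V G) i (V H) | splitAt-↑ˡ (V G) j (V H) = ⇔-id _

  comb-adj-↑ʳ : ∀ i j → Adj (comb X G H) (V G ↑ʳ i) (V G ↑ʳ j) ⇔ Adj H i j
  comb-adj-↑ʳ i j rewrite splitAt-↑ʳ (V G) (V H) i | splitAt-↑ʳ (V G) (V H) j = ⇔-id _

  comb-adj-cross : ∀ i j → Adj (comb X G H) (i ↑ˡ V H) (V G ↑ʳ j) ⇔ X
  comb-adj-cross i j rewrite splitAt-↑ˡ (V G) i (V H) | splitAt-↑ʳ (V G) (V H) j = ⇔-id _

cograph-vertex : ∀ {G} → IsCograph G → Fin (V G)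
cograph-vertex k1                   = zero
cograph-vertex (union {H = H} cG _) = cograph-vertex cG ↑ˡ V H
cograph-vertex (join {H = H} cG _)  = cograph-vertex cG ↑ˡ V H
cograph-vertex (iso G≅H cG)         = Inverse.to (_≅_.bij G≅H) (cograph-vertex cG)

record PermRep (L : Language) (G : Graph) : Set where
  field
    p q    : List (Fin (V G))
    p-perm : IsPermutation p
    q-perm : IsPermutation q
    adj    : ∀ {u v} → u ≢ v → Adj G u v ⇔ L (h u v p ++ h u v q)
open PermRep

module _ {L : Language} (symL : ZeroOneSymmetric L) where

  ⇔L++-cong : ∀ {A : Set} {x x′ y y′} → x ≡ x′ → y ≡ y′ → A ⇔ L (x′ ++ y′) → A ⇔ L (x ++ y)
  ⇔L++-cong refl refl A⇔L = A⇔L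

  adj-swap : ∀ {G} p q {u v : Fin (V G)} → u ≢ v →
    (Adj G u v ⇔ L (h u v p ++ h u v q)) → Adj G v u ⇔ L (h v u p ++ h v u q)
  adj-swap {G} p q {u} {v} u≢v adj-uv =
    subst (λ w → Adj G v u ⇔ L w) (≡-sym swapped)
          ((symL _ ⇔-∘ adj-uv) ⇔-∘ mk⇔ (sym G) (sym G))
    where
    swapped : h v u p ++ h v u q ≡ flip01 (h u v p ++ h u v q)
    swapped = trans (cong₂ _++_ (h-swap u v u≢v p) (h-swap u v u≢v q))
                    (≡-sym (map-++ not (h u v p) (h u v q)))

  K1-PermRep : PermRep L K1
  K1-PermRep = record
    { p = [ zero ] ; q = [ zero ]
    ; p-perm = λ { zero → refl } ; q-perm = λ { zero → refl }
    ; adj = λ { {zero} {zero} 0≢0 → contradiction refl 0≢0 }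
    }

  ≅-PermRep : ∀ {G H} → G ≅ H → PermRep L G → PermRep L H
  ≅-PermRep {G} {H} G≅H R = record
    { p = map φ (p R) ; q = map φ (q R)
    ; p-perm = λ u → trans (h-map-φ u u (p R)) (p-perm R (φ⁻¹ u))
    ; q-perm = λ u → trans (h-map-φ u u (q R)) (q-perm R (φ⁻¹ u))
    ; adj = adj′
    }
    where
    open Inverse (_≅_.bij G≅H) using (strictlyInverseˡ; inverseˡ; inverseʳ)
      renaming (to to φ; from to φ⁻¹)
    φ≡⇔≡φ⁻¹ : ∀ y x → φ x ≡ y ⇔ x ≡ φ⁻¹ y
    φ≡⇔≡φ⁻¹ y x = mk⇔ (λ e → ≡-sym (inverseʳ (≡-sym e))) inverseˡ
    h-map-φ : ∀ u v w → h u v (map φ w) ≡ h (φ⁻¹ u) (φ⁻¹ v) w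
    h-map-φ u v = h-map φ (λ x → h-[]-cong (φ≡⇔≡φ⁻¹ u x) (λ _ → φ≡⇔≡φ⁻¹ v x))
    adj-φ⁻¹ : ∀ u v → Adj H u v ⇔ Adj G (φ⁻¹ u) (φ⁻¹ v)
    adj-φ⁻¹ u v = ⇔-sym (subst₂ (λ a b → Adj G (φ⁻¹ u) (φ⁻¹ v) ⇔ Adj H a b)
                                 (strictlyInverseˡ u) (strictlyInverseˡ v)
                                 (_≅_.adj G≅H (φ⁻¹ u) (φ⁻¹ v)))
    φ⁻¹-≢ : ∀ {u v} → u ≢ v → φ⁻¹ u ≢ φ⁻¹ v
    φ⁻¹-≢ {u} {v} u≢v e =
      u≢v (trans (≡-sym (strictlyInverseˡ u)) (trans (cong φ e) (strictlyInverseˡ v)))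
    adj′ : ∀ {u v} → u ≢ v → Adj H u v ⇔ L (h u v (map φ (p R)) ++ h u v (map φ (q R)))
    adj′ {u} {v} u≢v =
      ⇔L++-cong (h-map-φ u v (p R)) (h-map-φ u v (q R)) (adj R (φ⁻¹-≢ u≢v) ⇔-∘ adj-φ⁻¹ u v)

  -- false ∷ true ∷ juxtapose s [ false ] [ true ] is h_{u,v}(p q) for u in G and v in H.
  comb-PermRep : ∀ {X G H} s → (X ⇔ L (false ∷ true ∷ juxtapose s [ false ] [ true ])) →
    PermRep L G → PermRep L H → PermRep L (comb X G H)
  comb-PermRep {X} {G} {H} s X⇔L RG RH = record
    { p = P ; q = Q
    ; p-perm = blocks-perm true (p RG) (p RH) (p-perm RG) (p-perm RH)
    ; q-perm = blocks-perm s (q RG) (q RH) (q-perm RG) (q-perm RH)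
    ; adj = adj′
    }
    where
    open Blocks (V G) (V H)
    P = blocks true (p RG) (p RH)
    Q = blocks s (q RG) (q RH)
    cross : ∀ i j → Adj (comb X G H) (i ↑ˡ V H) (V G ↑ʳ j) ⇔
      L (h (i ↑ˡ V H) (V G ↑ʳ j) P ++ h (i ↑ˡ V H) (V G ↑ʳ j) Q)
    cross i j = ⇔L++-cong (h-blocks-cross-perm true (p RG) (p RH) (p-perm RG) (p-perm RH) i j)
                          (h-blocks-cross-perm s (q RG) (q RH) (q-perm RG) (q-perm RH) i j)
                          (X⇔L ⇔-∘ comb-adj-cross X G H i j)
    adj′ : ∀ {u v} → u ≢ v → Adj (comb X G H) u v ⇔ L (h u v P ++ h u v Q)
    adj′ {u} {v} u≢v with side u | side v
    ... | left i  | left j  =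
      ⇔L++-cong (h-blocks-↑ˡ true i j (p RG) (p RH)) (h-blocks-↑ˡ s i j (q RG) (q RH))
                (adj RG (λ i≡j → u≢v (cong (_↑ˡ V H) i≡j)) ⇔-∘ comb-adj-↑ˡ X G H i j)
    ... | right i | right j =
      ⇔L++-cong (h-blocks-↑ʳ true i j (p RG) (p RH)) (h-blocks-↑ʳ s i j (q RG) (q RH))
                (adj RH (λ i≡j → u≢v (cong (V G ↑ʳ_) i≡j)) ⇔-∘ comb-adj-↑ʳ X G H i j)
    ... | left i  | right j = cross i j
    ... | right j | left i  = adj-swap {comb X G H} P Q (↑ˡ≢↑ʳ i j) (cross i j)

  cograph-PermRep : ∀ s t →
    ¬ L (false ∷ true ∷ juxtapose s [ false ] [ true ]) →
    L (false ∷ true ∷ juxtapose t [ false ] [ true ]) →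
    ∀ {G} → IsCograph G → PermRep L G
  cograph-PermRep s t rejected accepted = go
    where
    go : ∀ {G} → IsCograph G → PermRep L G
    go k1            = K1-PermRep
    go (union cG cH) = comb-PermRep s (mk⇔ ⊥-elim rejected) (go cG) (go cH)
    go (join cG cH)  = comb-PermRep t (mk⇔ (λ _ → accepted) (λ _ → tt)) (go cG) (go cH)
    go (iso G≅H cG)  = ≅-PermRep G≅H (go cG)

  PermRep⇒Representable : ∀ {G} → PermRep L G → Fin (V G) → Representable L symL G
  PermRep⇒Representable {G} R x₀ =
    V G , p R ++ q R , nonempty , (λ x → ∈-++⁺ˡ (∈p x)) , record { bij = ↔-id _ ; adj = adj′ }
    where
    ∈p : ∀ x → x ∈ p R
    ∈p x = h≡false∷⇒∈ (p R) (p-perm R x)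
    nonempty : p R ++ q R ≢ []
    nonempty eq = ¬Any[] (subst (x₀ ∈_) eq (∈-++⁺ˡ (∈p x₀)))
    adj′ : ∀ u v → Adj G u v ⇔ (u ≢ v × L (h u v (p R ++ q R)))
    adj′ u v with u ≟ v
    ... | yes refl = mk⇔ (λ a → contradiction a (irr G)) (λ (u≢u , _) → contradiction refl u≢u)
    ... | no u≢v   = mk⇔ (λ a → u≢v , subst L (≡-sym split) (to (adj R u≢v) a))
                         (λ (_ , l) → from (adj R u≢v) (subst L split l))
      where split = h-++ u v (p R) (q R)

mainTheorem3 : (L : Language) (symL : ZeroOneSymmetric L) →
    ((L (true ∷ false ∷ false ∷ true ∷ []) × L (false ∷ true ∷ true ∷ false ∷ []))
      ⊎ (L (true ∷ false ∷ true ∷ false ∷ []) × L (false ∷ true ∷ false ∷ true ∷ []))) →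
    ¬ (L (true ∷ false ∷ false ∷ true ∷ []) × L (false ∷ true ∷ true ∷ false ∷ [])
        × L (true ∷ false ∷ true ∷ false ∷ []) × L (false ∷ true ∷ false ∷ true ∷ [])) →
    ∀ (G : Graph) → IsCograph G → Representable L symL G
mainTheorem3 L symL (inj₁ (l1001 , l0110)) notAll G cG =
  PermRep⇒Representable symL (cograph-PermRep symL true false ¬l0101 l0110 cG)
                             (cograph-vertex cG)
  where
  ¬l0101 : ¬ L (false ∷ true ∷ false ∷ true ∷ [])
  ¬l0101 l0101 = notAll (l1001 , l0110 , to (symL _) l0101 , l0101)
mainTheorem3 L symL (inj₂ (l1010 , l0101)) notAll G cG =
  PermRep⇒Representable symL (cograph-PermRep symL false true ¬l0110 l0101 cG)
                             (cograph-vertex cG)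
  where
  ¬l0110 : ¬ L (false ∷ true ∷ true ∷ false ∷ [])
  ¬l0110 l0110 = notAll (to (symL _) l0110 , l0110 , l1010 , l0101)
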